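{- Let $G=(V,E)$ be a connected simple graph, let $e=uv\in E$ be an arbitrary edge, and let $S\subseteq V$ be a mixed resolving set of $G$. Then $V_{>,uv}\cap S\neq\emptyset$ and $V_{<,uv}\cap S\neq\emptyset$, where $V_{<,uv}=\{w\in V : d(u,w)<d(v,w)\}$ and $V_{>,uv}=\{w\in V : d(u,w)>d(v,w)\}$.
   Context: For vertices $u,v$, $d(u,v)$ is the number of edges on a shortest $u$–$v$ path. For a vertex $w$ and an edge $e=uv$, $d(w,e)=\min(d(w,u),d(w,v))$. A vertex $w$ resolves two elements $x,y\in V\cup E$ if $d(w,x)\neq d(w,y)$. A set $S\subseteq V$ is a mixed resolving set if every pair of distinct elements of $V\cup E$ is resolved by some element of $S$. -}

module Defs where

open import Data.Nat using (ℕ; zero; suc; _≤_; _<_; _⊓_)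
open import Data.Fin using (Fin)
open import Data.Product using (Σ; _×_; _,_; ∃)
open import Data.Sum using (_⊎_)
open import Data.Empty using (⊥)
open import Relation.Nullary using (¬_)
open import Relation.Binary.PropositionalEquality using (_≡_)

record Graph (n : ℕ) : Set₁ where
  field
    Adj     : Fin n → Fin n → Set
    irrefl  : ∀ {x} → ¬ Adj x x
    sym     : ∀ {x y} → Adj x y → Adj y x
open Graph public

data Walk {n} (G : Graph n) : Fin n → Fin n → ℕ → Set where
  here  : ∀ {x} → Walk G x x zero
  step  : ∀ {x y z k} → Adj G x y → Walk G y z k → Walk G x z (suc k)

Connected : ∀ {n} → Graph n → Set
Connected {n} G = ∀ (x y : Fin n) → ∃ λ k → Walk G x y k

IsDist : ∀ {n} → Graph n → Fin n → Fin n → ℕ → Set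
IsDist G x y k = Walk G x y k × (∀ m → Walk G x y m → k ≤ m)

-- Elements of V ∪ E: a vertex, or an edge given by an ordered pair of adjacent
-- endpoints (the unordered edge {a,b} has the two representations (a,b),(b,a)).
data Elem {n} (G : Graph n) : Set where
  vtx  : Fin n → Elem G
  edge : (a b : Fin n) → Adj G a b → Elem G

SameElem : ∀ {n} {G : Graph n} → Elem G → Elem G → Set
SameElem (vtx x)      (vtx y)      = x ≡ y
SameElem (vtx _)      (edge _ _ _) = ⊥
SameElem (edge _ _ _) (vtx _)      = ⊥
SameElem (edge a b _) (edge c d _) = (a ≡ c × b ≡ d) ⊎ (a ≡ d × b ≡ c)

IsElemDist : ∀ {n} (G : Graph n) → Fin n → Elem G → ℕ → Set
IsElemDist G w (vtx x)      k = IsDist G w x k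
IsElemDist G w (edge a b _) k =
  Σ ℕ λ ka → Σ ℕ λ kb → IsDist G w a ka × IsDist G w b kb × k ≡ ka ⊓ kb

Resolves : ∀ {n} (G : Graph n) → Fin n → Elem G → Elem G → Set
Resolves G w x y = ∀ kx ky → IsElemDist G w x kx → IsElemDist G w y ky → ¬ kx ≡ ky

MixedResolving : ∀ {n} (G : Graph n) → (Fin n → Set) → Set
MixedResolving {n} G S =
  ∀ (x y : Elem G) → ¬ SameElem x y → ∃ λ (w : Fin n) → S w × Resolves G w x y

module Submission where

-- A mixed resolving set must distinguish the vertex u from
-- the edge uv.  Since d(w,uv) = min(d(w,u), d(w,v)), a vertex w with
-- d(w,u) ≠ min(d(w,u), d(w,v)) necessarily satisfies d(w,v) < d(w,u), i.e.
-- w ∈ V_{>,uv}.  Symmetrically, resolving v from the edge vu yields a vertex of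
-- S in V_{<,uv}.

open import Defs
open import Data.Nat using (_<_; _+_; suc; _⊓_)
open import Data.Nat.Properties using (+-suc; +-identityʳ; m≤n⇒m⊓n≡m; ≰⇒>)
open import Data.Fin using (Fin)
open import Data.Product using (_×_; ∃; _,_)
open import Relation.Nullary using (¬_)
open import Relation.Binary.PropositionalEquality as Eq using (_≡_; refl; subst)

reverseOnto : ∀ {n} {G : Graph n} {x y z k j} →
              Walk G y z k → Walk G y x j → Walk G z x (k + j)
reverseOnto here acc = acc
reverseOnto {G = G} {x} {z = z} {k = suc k} {j} (step a w) acc =
  subst (Walk G z x) (+-suc k j) (reverseOnto w (step (sym G a) acc))

reverse : ∀ {n} {G : Graph n} {x y k} → Walk G x y k → Walk G y x k
reverse {G = G} {x} {y} {k} w = subst (Walk G y x) (+-identityʳ k) (reverseOnto w here)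

distSym : ∀ {n} {G : Graph n} {x y k} → IsDist G x y k → IsDist G y x k
distSym (p , shortest) = reverse p , λ m q → shortest m (reverse q)

≢⊓⇒> : ∀ {m n} → ¬ (m ≡ m ⊓ n) → n < m
≢⊓⇒> ne = ≰⇒> (λ m≤n → ne (Eq.sym (m≤n⇒m⊓n≡m m≤n)))

resolvesEndpoint⇒closer : ∀ {n} (G : Graph n) {w x y : Fin n} (a : Adj G x y) →
                          Resolves G w (vtx x) (edge x y a) →
                          ∀ dx dy → IsDist G x w dx → IsDist G y w dy → dy < dx
resolvesEndpoint⇒closer G a resolves dx dy hx hy =
  ≢⊓⇒> (resolves dx (dx ⊓ dy) (distSym hx) (dx , dy , distSym hx , distSym hy , refl))

closerToSecondEndpoint : ∀ {n} (G : Graph n) (x y : Fin n) (a : Adj G x y) →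
                         (S : Fin n → Set) → MixedResolving G S →
                         ∃ λ (w : Fin n) → S w ×
                           (∀ dx dy → IsDist G x w dx → IsDist G y w dy → dy < dx)
closerToSecondEndpoint G x y a S mixed with mixed (vtx x) (edge x y a) (λ ())
... | w , w∈S , resolves = w , w∈S , resolvesEndpoint⇒closer G a resolves

lemma1 : ∀ {n} (G : Graph n) → Connected G →
         (u v : Fin n) → Adj G u v →
         (S : Fin n → Set) → MixedResolving G S →
         (∃ λ (w : Fin n) → S w × (∀ du dv → IsDist G u w du → IsDist G v w dv → dv < du))
         × (∃ λ (w : Fin n) → S w × (∀ du dv → IsDist G u w du → IsDist G v w dv → du < dv))
lemma1 G _ u v a S mixed = closerToSecondEndpoint G u v a S mixed , closerToV
  where
  closerToV : ∃ λ w → S w × (∀ du dv → IsDist G u w du → IsDist G v w dv → du < dv)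
  closerToV with closerToSecondEndpoint G v u (sym G a) S mixed
  ... | w , w∈S , closer = w , w∈S , λ du dv hu hv → closer dv du hv hu
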